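{- For every integer $n\geq 1$: (1) the number of overpartitions $\pi$ of $n$ with $\ell_{O\geq N}(\pi)$ even (resp. odd) equals the number of overpartitions $\lambda$ of $n$ with $\ell_{O\leq N}(\lambda)$ even (resp. odd); (2) the number of overpartitions $\pi$ of $n$ such that non-overlined parts appear in $\pi$ and $\ell_{O\geq N}(\pi)$ is even (resp. odd) equals the number of overpartitions $\lambda$ of $n$ such that non-overlined parts appear in $\lambda$ and $\ell_{O\leq N}(\lambda)$ is even (resp. odd).
   Context: An overpartition of $n$ is a partition of $n$ (finite non-increasing sequence of positive integers summing to $n$) in which the first occurrence of each distinct part size may be overlined. A part is of size $t$ if it equals $t$ or $\overline{t}$. For an overpartition $\pi$, let $SN(\pi)$ be the size of the smallest non-overlined part of $\pi$ if $\pi$ has non-overlined parts and $0$ otherwise, and let $\widetilde{LN}(\pi)$ be the size of the largest non-overlined part of $\pi$ if $\pi$ has non-overlined parts and $+\infty$ otherwise. $\ell_{O\geq N}(\pi)$ is the number of overlined parts of $\pi$ of size $\geq SN(\pi)$, and $\ell_{O\leq N}(\pi)$ is the number of overlined parts of $\pi$ of size $\leq \widetilde{LN}(\pi)$. -}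

module Defs where

open import Data.Nat using (ℕ; zero; suc; _+_; _≤ᵇ_; _<ᵇ_; _≡ᵇ_; _%_)
open import Data.Bool using (Bool; true; false; _∧_; _∨_; not; if_then_else_)
open import Data.List using (List; []; _∷_; filter; length; map; foldr)
open import Data.Product using (_×_; _,_; proj₁; proj₂)
open import Data.Maybe using (Maybe; just; nothing)

Part : Set
Part = ℕ × Bool

size : Part → ℕ
size = proj₁

overlined : Part → Bool
overlined = proj₂

-- An overpartition is represented as a list of parts, written in
-- non-increasing order of size; among parts of equal size the (at most one)
-- overlined copy comes first (it is the "first occurrence").
-- `p` may be followed immediately by `q` iff size q < size p, or
-- size q = size p and q is not overlined.
canFollow : Part → Part → Bool
canFollow p q = (size q <ᵇ size p) ∨ ((size q ≡ᵇ size p) ∧ not (overlined q))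

ordered : List Part → Bool
ordered [] = true
ordered (p ∷ []) = true
ordered (p ∷ q ∷ ps) = canFollow p q ∧ ordered (q ∷ ps)

allPositive : List Part → Bool
allPositive [] = true
allPositive (p ∷ ps) = (1 ≤ᵇ size p) ∧ allPositive ps

total : List Part → ℕ
total [] = 0
total (p ∷ ps) = size p + total ps

-- Boolean (hence proof-irrelevant) test: π is an overpartition of n
isOverpartitionOf : ℕ → List Part → Bool
isOverpartitionOf n π = allPositive π ∧ ordered π ∧ (total π ≡ᵇ n)

nonOverlinedSizes : List Part → List ℕ
nonOverlinedSizes [] = []
nonOverlinedSizes (p ∷ ps) =
  if overlined p then nonOverlinedSizes ps else size p ∷ nonOverlinedSizes ps

hasNonOverlined : List Part → Bool
hasNonOverlined π with nonOverlinedSizes π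
... | [] = false
... | _ ∷ _ = true

minL : ℕ → List ℕ → ℕ
minL m [] = m
minL m (x ∷ xs) = minL (if x <ᵇ m then x else m) xs

maxL : ℕ → List ℕ → ℕ
maxL m [] = m
maxL m (x ∷ xs) = maxL (if m <ᵇ x then x else m) xs

SN : List Part → ℕ
SN π with nonOverlinedSizes π
... | [] = 0
... | x ∷ xs = minL x xs

-- LN~(π): largest non-overlined part size; `nothing` stands for +∞
LN~ : List Part → Maybe ℕ
LN~ π with nonOverlinedSizes π
... | [] = nothing
... | x ∷ xs = just (maxL x xs)

countParts : (Part → Bool) → List Part → ℕ
countParts P [] = 0
countParts P (p ∷ ps) = if P p then suc (countParts P ps) else countParts P ps

ℓO≥N : List Part → ℕ
ℓO≥N π = countParts (λ p → overlined p ∧ (SN π ≤ᵇ size p)) π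

≤∞ᵇ : ℕ → Maybe ℕ → Bool
≤∞ᵇ t nothing = true
≤∞ᵇ t (just m) = t ≤ᵇ m

ℓO≤N : List Part → ℕ
ℓO≤N π = countParts (λ p → overlined p ∧ ≤∞ᵇ (size p) (LN~ π)) π

isEven : ℕ → Bool
isEven n = n % 2 ≡ᵇ 0

module Submission where

-- The bijection is an involution φ on overpartitions of n that carries the parity of ℓO≥N to
-- that of ℓO≤N and preserves whether non-overlined parts occur.  If some size is repeated,
-- flipping the overline of the first copy of the largest repeated size (its next copy is
-- non-overlined) keeps the set of non-overlined sizes, hence SN and LN~, and changes both
-- ℓO≥N and ℓO≤N by one, because that size lies between SN and LN~; φ does this exactly when
-- the two parities differ.  If all sizes are distinct then, reading from the largest part,
-- ℓO≥N counts the overlined parts before the last non-overlined one and ℓO≤N those after the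
-- first one (all of them if there is none); φ reverses the sequence of overline marks, which
-- exchanges the two counts.

open import Defs
open import Data.Bool using (Bool; true; false; T; not; _∧_; _∨_; _xor_; if_then_else_)
open import Data.Bool.Properties
  using (T-∧; T-∨; T-≡; T-irrelevant; not-involutive; xor-annihilates-not; ∧-identityʳ; ∧-comm; ∨-conicalˡ; ∨-conicalʳ; if-float)
  renaming (_≟_ to _≟ᵇ_)
open import Data.Empty using (⊥-elim)
open import Data.List using (List; []; _∷_; _∷ʳ_; length; map; reverse; zip; unzip; null)
open import Data.Bool.ListAction using (and; all)
open import Data.Nat.ListAction using (sum)
open import Data.List.Properties using (unfold-reverse; reverse-involutive; length-map; length-reverse; unzip-zip; zip-unzip)
open import Data.List.Membership.Propositional using (_∈_)
open import Data.List.Relation.Unary.All as All using (All; []; _∷_)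
open import Data.List.Relation.Unary.Any using (here; there)
open import Data.List.Relation.Unary.Linked as Linked using (Linked; []; [-]; _∷_)
open import Data.List.Relation.Unary.Linked.Properties using (Linked⇒All)
open import Data.Maybe using (Maybe; just; nothing)
open import Data.Nat using (ℕ; zero; suc; _+_; _≤_; _<_; _>_; _≥_; _≤ᵇ_; _<ᵇ_; _≡ᵇ_; s≤s)
open import Data.Nat.Properties
  using (≤-refl; ≤-trans; <⇒≤; <-trans; <⇒≱; ≮⇒≥; <ᵇ⇒<; <⇒<ᵇ; ≤⇒≤ᵇ; ≡ᵇ⇒≡; ≡⇒≡ᵇ)
open import Data.Product using (Σ; _×_; _,_; proj₁; proj₂)
import Data.Product as Product
open import Data.Sum using (_⊎_; inj₁; inj₂; [_,_]′)
import Data.Sum as Sum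
open import Data.Unit using (tt)
open import Function using (_∘_)
open import Function.Bundles using (_↔_; mk↔ₛ′; Equivalence)
open import Relation.Binary.PropositionalEquality
  using (_≡_; refl; sym; trans; cong; cong₂; subst; module ≡-Reasoning)
open import Axiom.UniquenessOfIdentityProofs using (module Decidable⇒UIP)

T-∧⁻ : ∀ {x y} → T (x ∧ y) → T x × T y
T-∧⁻ = Equivalence.to T-∧

T-∧⁺ : ∀ {x y} → T x → T y → T (x ∧ y)
T-∧⁺ a b = Equivalence.from T-∧ (a , b)

≡true⇒T : ∀ {x} → x ≡ true → T x
≡true⇒T = Equivalence.from T-≡

xor≡true⇒not≡ : ∀ a b → a xor b ≡ true → not b ≡ a
xor≡true⇒not≡ true  false _ = refl
xor≡true⇒not≡ false true  _ = refl

xor≡false⇒≡ : ∀ a b → a xor b ≡ false → b ≡ a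
xor≡false⇒≡ true  true  _ = refl
xor≡false⇒≡ false false _ = refl

isEven-suc : ∀ n → isEven (suc n) ≡ not (isEven n)
isEven-suc zero = refl
isEven-suc (suc zero) = refl
isEven-suc (suc (suc n)) = isEven-suc n

isEven-neighbours : ∀ {m n} → m ≡ suc n ⊎ suc m ≡ n → isEven m ≡ not (isEven n)
isEven-neighbours {n = n} (inj₁ refl) = isEven-suc n
isEven-neighbours {m} (inj₂ refl) =
  trans (sym (not-involutive (isEven m))) (cong not (sym (isEven-suc m)))

<ᵇ-irrefl : ∀ n → (n <ᵇ n) ≡ false
<ᵇ-irrefl zero    = refl
<ᵇ-irrefl (suc n) = <ᵇ-irrefl n

<ᵇ≡true⇒< : ∀ {m n} → (m <ᵇ n) ≡ true → m < n
<ᵇ≡true⇒< {m} {n} e = <ᵇ⇒< m n (≡true⇒T e)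

<ᵇ≡false⇒≥ : ∀ {m n} → (m <ᵇ n) ≡ false → n ≤ m
<ᵇ≡false⇒≥ e = ≮⇒≥ (λ m<n → subst T e (<⇒<ᵇ m<n))

<⇒<ᵇ≡true : ∀ {m n} → m < n → (m <ᵇ n) ≡ true
<⇒<ᵇ≡true m<n = Equivalence.to T-≡ (<⇒<ᵇ m<n)

≤⇒≤ᵇ≡true : ∀ {m n} → m ≤ n → (m ≤ᵇ n) ≡ true
≤⇒≤ᵇ≡true m≤n = Equivalence.to T-≡ (≤⇒≤ᵇ m≤n)

≥⇒<ᵇ≡false : ∀ {m n} → n ≤ m → (m <ᵇ n) ≡ false
≥⇒<ᵇ≡false {m} {n} n≤m with m <ᵇ n in e
... | false = refl
... | true  = ⊥-elim (<⇒≱ (<ᵇ≡true⇒< e) n≤m)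

<⇒≤ᵇ≡false : ∀ {m n} → m < n → (n ≤ᵇ m) ≡ false
<⇒≤ᵇ≡false (s≤s m≤n) = ≥⇒<ᵇ≡false m≤n

-- Involutions exchanging two Boolean statistics

proj₁-injective : {A : Set} {valid h : A → Bool} {e : Bool} {x y : A}
  {p : T (valid x) × h x ≡ e} {q : T (valid y) × h y ≡ e} →
  x ≡ y → _≡_ {A = Σ A (λ z → T (valid z) × h z ≡ e)} (x , p) (y , q)
proj₁-injective {p = v , hx} {q = w , hy} refl =
  cong₂ (λ v′ h′ → _ , v′ , h′) (T-irrelevant v w) (Decidable⇒UIP.≡-irrelevant _≟ᵇ_ hx hy)

record InvolutionExchanging {A : Set} (valid f g : A → Bool) : Set where
  field
    φ            : A → A
    φ-valid      : ∀ x → T (valid x) → T (valid (φ x))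
    φ-involutive : ∀ x → T (valid x) → φ (φ x) ≡ x
    g∘φ          : ∀ x → T (valid x) → g (φ x) ≡ f x

  f∘φ : ∀ x → T (valid x) → f (φ x) ≡ g x
  f∘φ x v = trans (sym (g∘φ (φ x) (φ-valid x v))) (cong g (φ-involutive x v))

  ↔-exchange : ∀ e → Σ A (λ x → T (valid x) × f x ≡ e) ↔ Σ A (λ x → T (valid x) × g x ≡ e)
  ↔-exchange e =
    mk↔ₛ′ (λ (x , v , fx) → φ x , φ-valid x v , trans (g∘φ x v) fx)
          (λ (x , v , gx) → φ x , φ-valid x v , trans (f∘φ x v) gx)
          (λ (x , v , _) → proj₁-injective (φ-involutive x v))
          (λ (x , v , _) → proj₁-injective (φ-involutive x v))

  restrict : (h : A → Bool) → (∀ x → T (valid x) → h (φ x) ≡ h x) →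
    InvolutionExchanging (λ x → valid x ∧ h x) f g
  restrict h h∘φ = record
    { φ            = φ
    ; φ-valid      = λ x vh → let (v , hx) = T-∧⁻ {valid x} vh
                              in T-∧⁺ (φ-valid x v) (subst T (sym (h∘φ x v)) hx)
    ; φ-involutive = λ x vh → φ-involutive x (proj₁ (T-∧⁻ {valid x} vh))
    ; g∘φ          = λ x vh → g∘φ x (proj₁ (T-∧⁻ {valid x} vh))
    }

module PiecewiseInvolution {A : Set} (valid f g c : A → Bool) (t r : A → A)
  (t-valid      : ∀ x → T (valid x) → c x ≡ true → T (valid (t x)))
  (t-class      : ∀ x → T (valid x) → c x ≡ true → c (t x) ≡ true)
  (t-involutive : ∀ x → T (valid x) → c x ≡ true → t (t x) ≡ x)
  (t-flips-f    : ∀ x → T (valid x) → c x ≡ true → f (t x) ≡ not (f x))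
  (t-flips-g    : ∀ x → T (valid x) → c x ≡ true → g (t x) ≡ not (g x))
  (r-valid      : ∀ x → T (valid x) → c x ≡ false → T (valid (r x)))
  (r-class      : ∀ x → T (valid x) → c x ≡ false → c (r x) ≡ false)
  (r-involutive : ∀ x → T (valid x) → c x ≡ false → r (r x) ≡ x)
  (g∘r          : ∀ x → T (valid x) → c x ≡ false → g (r x) ≡ f x)
  where

  φ : A → A
  φ x = if c x then (if f x xor g x then t x else x) else r x

  data Branch (x : A) : Set where
    toggled  : c x ≡ true → f x xor g x ≡ true → φ x ≡ t x → Branch x
    kept     : c x ≡ true → f x xor g x ≡ false → φ x ≡ x → Branch x
    reversed : c x ≡ false → φ x ≡ r x → Branch x

  branch : ∀ x → Branch x
  branch x = go (c x) (f x xor g x) refl refl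
    where
    select : Bool → Bool → A
    select a b = if a then (if b then t x else x) else r x
    go : ∀ a b → c x ≡ a → f x xor g x ≡ b → Branch x
    go true  true  ec em = toggled ec em (cong₂ select ec em)
    go true  false ec em = kept ec em (cong₂ select ec em)
    go false _     ec em = reversed ec (cong₂ select ec em)

  φ-valid : ∀ x → T (valid x) → T (valid (φ x))
  φ-valid x v with branch x
  ... | toggled ec _ eq = subst (T ∘ valid) (sym eq) (t-valid x v ec)
  ... | kept _ _ eq     = subst (T ∘ valid) (sym eq) v
  ... | reversed ec eq  = subst (T ∘ valid) (sym eq) (r-valid x v ec)

  φ-invariant : {B : Set} (h : A → B) →
    (∀ x → T (valid x) → c x ≡ true → h (t x) ≡ h x) →
    (∀ x → T (valid x) → c x ≡ false → h (r x) ≡ h x) →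
    ∀ x → T (valid x) → h (φ x) ≡ h x
  φ-invariant h h∘t h∘r x v with branch x
  ... | toggled ec _ eq = trans (cong h eq) (h∘t x v ec)
  ... | kept _ _ eq     = cong h eq
  ... | reversed ec eq  = trans (cong h eq) (h∘r x v ec)

  g∘φ : ∀ x → T (valid x) → g (φ x) ≡ f x
  g∘φ x v with branch x
  ... | toggled ec em eq = trans (cong g eq) (trans (t-flips-g x v ec) (xor≡true⇒not≡ (f x) (g x) em))
  ... | kept _ em eq     = trans (cong g eq) (xor≡false⇒≡ (f x) (g x) em)
  ... | reversed ec eq   = trans (cong g eq) (g∘r x v ec)

  φ-involutive : ∀ x → T (valid x) → φ (φ x) ≡ x
  φ-involutive x v with branch x
  ... | kept _ _ eq = trans (cong φ eq) eq
  ... | toggled ec em eq = trans (cong φ eq) (φ∘t (branch (t x)))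
    where
    same-mismatch : f (t x) xor g (t x) ≡ true
    same-mismatch = begin
      f (t x) xor g (t x)     ≡⟨ cong₂ _xor_ (t-flips-f x v ec) (t-flips-g x v ec) ⟩
      not (f x) xor not (g x) ≡⟨ xor-annihilates-not (f x) (g x) ⟩
      f x xor g x             ≡⟨ em ⟩
      true                    ∎
      where open ≡-Reasoning
    φ∘t : Branch (t x) → φ (t x) ≡ x
    φ∘t (toggled _ _ eq′) = trans eq′ (t-involutive x v ec)
    φ∘t (kept _ em′ _)    with () ← trans (sym em′) same-mismatch
    φ∘t (reversed ec′ _)  with () ← trans (sym ec′) (t-class x v ec)
  ... | reversed ec eq = trans (cong φ eq) (φ∘r (branch (r x)))
    where
    φ∘r : Branch (r x) → φ (r x) ≡ x
    φ∘r (toggled ec′ _ _) with () ← trans (sym ec′) (r-class x v ec)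
    φ∘r (kept ec′ _ _)    with () ← trans (sym ec′) (r-class x v ec)
    φ∘r (reversed _ eq′)  = trans eq′ (r-involutive x v ec)

  involution : InvolutionExchanging valid f g
  involution = record { φ = φ ; φ-valid = φ-valid ; φ-involutive = φ-involutive ; g∘φ = g∘φ }

minL≤seed : ∀ m xs → minL m xs ≤ m
minL≤seed m [] = ≤-refl
minL≤seed m (x ∷ xs) with x <ᵇ m in e
... | true  = ≤-trans (minL≤seed x xs) (<⇒≤ (<ᵇ≡true⇒< e))
... | false = minL≤seed m xs

minL≤∈ : ∀ m xs {y} → y ∈ xs → minL m xs ≤ y
minL≤∈ m (x ∷ xs) (here refl) with x <ᵇ m in e
... | true  = minL≤seed x xs
... | false = ≤-trans (minL≤seed m xs) (<ᵇ≡false⇒≥ e)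
minL≤∈ m (x ∷ xs) (there y∈xs) = minL≤∈ _ xs y∈xs

seed≤maxL : ∀ m xs → m ≤ maxL m xs
seed≤maxL m [] = ≤-refl
seed≤maxL m (x ∷ xs) with m <ᵇ x in e
... | true  = ≤-trans (<⇒≤ (<ᵇ≡true⇒< e)) (seed≤maxL x xs)
... | false = seed≤maxL m xs

∈≤maxL : ∀ m xs {y} → y ∈ xs → y ≤ maxL m xs
∈≤maxL m (x ∷ xs) (here refl) with m <ᵇ x in e
... | true  = seed≤maxL x xs
... | false = ≤-trans (<ᵇ≡false⇒≥ e) (seed≤maxL m xs)
∈≤maxL m (x ∷ xs) (there y∈xs) = ∈≤maxL _ xs y∈xs

minL-below-seed : ∀ {s x} xs → x < s → minL s (x ∷ xs) ≡ minL x xs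
minL-below-seed xs x<s rewrite <⇒<ᵇ≡true x<s = refl

maxL-seed : ∀ m xs → All (_< m) xs → maxL m xs ≡ m
maxL-seed m [] [] = refl
maxL-seed m (x ∷ xs) (x<m ∷ xs<m) rewrite ≥⇒<ᵇ≡false (<⇒≤ x<m) = maxL-seed m xs xs<m

maxL< : ∀ {s} m xs → All (_< s) (m ∷ xs) → maxL m xs < s
maxL< m [] (m<s ∷ []) = m<s
maxL< m (x ∷ xs) (m<s ∷ x<s ∷ xs<s) with m <ᵇ x
... | true  = maxL< x xs (x<s ∷ xs<s)
... | false = maxL< m xs (m<s ∷ xs<s)

smallest : List ℕ → ℕ
smallest []       = 0
smallest (x ∷ xs) = minL x xs

largest : List ℕ → Maybe ℕ
largest []       = nothing
largest (x ∷ xs) = just (maxL x xs)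

SN≡smallest : ∀ π → SN π ≡ smallest (nonOverlinedSizes π)
SN≡smallest π with nonOverlinedSizes π
... | []    = refl
... | _ ∷ _ = refl

LN~≡largest : ∀ π → LN~ π ≡ largest (nonOverlinedSizes π)
LN~≡largest π with nonOverlinedSizes π
... | []    = refl
... | _ ∷ _ = refl

hasNonOverlined≡not-null : ∀ π → hasNonOverlined π ≡ not (null (nonOverlinedSizes π))
hasNonOverlined≡not-null π with nonOverlinedSizes π
... | []    = refl
... | _ ∷ _ = refl

smallest≤∈ : ∀ xs {d} → d ∈ xs → smallest xs ≤ d
smallest≤∈ (x ∷ xs) (here refl)  = minL≤seed x xs
smallest≤∈ (x ∷ xs) (there d∈xs) = minL≤∈ x xs d∈xs

∈≤largest : ∀ xs {d} → d ∈ xs → ≤∞ᵇ d (largest xs) ≡ true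
∈≤largest (x ∷ xs) (here refl)  = ≤⇒≤ᵇ≡true (seed≤maxL x xs)
∈≤largest (x ∷ xs) (there d∈xs) = ≤⇒≤ᵇ≡true (∈≤maxL x xs d∈xs)

data Stutter : List ℕ → List ℕ → Set where
  duplicate : ∀ d zs → Stutter (d ∷ zs) (d ∷ d ∷ zs)
  skip      : ∀ x {xs ys} → Stutter xs ys → Stutter (x ∷ xs) (x ∷ ys)

minL-stutter : ∀ {xs ys} → Stutter xs ys → ∀ m → minL m xs ≡ minL m ys
minL-stutter (duplicate d zs) m with d <ᵇ m in e
... | true  rewrite <ᵇ-irrefl d = refl
... | false rewrite e = refl
minL-stutter (skip x s) m = minL-stutter s _

maxL-stutter : ∀ {xs ys} → Stutter xs ys → ∀ m → maxL m xs ≡ maxL m ys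
maxL-stutter (duplicate d zs) m with m <ᵇ d in e
... | true  rewrite <ᵇ-irrefl d = refl
... | false rewrite e = refl
maxL-stutter (skip x s) m = maxL-stutter s _

smallest-stutter : ∀ {xs ys} → Stutter xs ys → smallest xs ≡ smallest ys
smallest-stutter (duplicate d zs) rewrite <ᵇ-irrefl d = refl
smallest-stutter (skip x s) = minL-stutter s x

largest-stutter : ∀ {xs ys} → Stutter xs ys → largest xs ≡ largest ys
largest-stutter (duplicate d zs) rewrite <ᵇ-irrefl d = refl
largest-stutter (skip x s) = cong just (maxL-stutter s x)

null-stutter : ∀ {xs ys} → Stutter xs ys → null xs ≡ null ys
null-stutter (duplicate _ _) = refl
null-stutter (skip _ _)      = refl

repeats : List ℕ → Bool
repeats []           = false
repeats (_ ∷ [])     = false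
repeats (s ∷ t ∷ ts) = (s ≡ᵇ t) ∨ repeats (t ∷ ts)

allPositive≡all : ∀ π → allPositive π ≡ all (1 ≤ᵇ_) (map size π)
allPositive≡all []       = refl
allPositive≡all (p ∷ ps) = cong ((1 ≤ᵇ size p) ∧_) (allPositive≡all ps)

total≡sum : ∀ π → total π ≡ sum (map size π)
total≡sum []       = refl
total≡sum (p ∷ ps) = cong (size p +_) (total≡sum ps)

isOverpartitionOf-resize : ∀ n {π π′} → map size π′ ≡ map size π → T (ordered π′) →
  T (isOverpartitionOf n π) → T (isOverpartitionOf n π′)
isOverpartitionOf-resize n {π} {π′} same o v =
  T-∧⁺ (subst T positive all-positive) (T-∧⁺ o (subst T (cong (_≡ᵇ n) weight) right-total))
  where
  all-positive : T (allPositive π)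
  all-positive = proj₁ (T-∧⁻ {allPositive π} v)
  right-total : T (total π ≡ᵇ n)
  right-total = proj₂ (T-∧⁻ {ordered π} (proj₂ (T-∧⁻ {allPositive π} v)))
  positive : allPositive π ≡ allPositive π′
  positive = trans (allPositive≡all π) (trans (cong (all (1 ≤ᵇ_)) (sym same)) (sym (allPositive≡all π′)))
  weight : total π ≡ total π′
  weight = trans (total≡sum π) (trans (cong sum (sym same)) (sym (total≡sum π′)))

ordered-head : ∀ p q qs → T (ordered (p ∷ q ∷ qs)) → T (canFollow p q)
ordered-head p q _ = proj₁ ∘ T-∧⁻ {canFollow p q}

ordered-tail : ∀ p q qs → T (ordered (p ∷ q ∷ qs)) → T (ordered (q ∷ qs))
ordered-tail p q _ = proj₂ ∘ T-∧⁻ {canFollow p q}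

canFollow-≢⇒< : ∀ p q → T (canFollow p q) → (size p ≡ᵇ size q) ≡ false → size q < size p
canFollow-≢⇒< (s , b) (t , c) cf ne with t <ᵇ s in lt
... | true  = <ᵇ≡true⇒< lt
... | false with ≡ᵇ⇒≡ t s (proj₁ (T-∧⁻ {t ≡ᵇ s} cf))
...   | refl = ⊥-elim (subst T ne (≡⇒≡ᵇ t t refl))

canFollow-≡ : ∀ s b t c → T (canFollow (s , b) (t , c)) → (s ≡ᵇ t) ≡ true → s ≡ t × c ≡ false
canFollow-≡ s b t c cf eq with ≡ᵇ⇒≡ s t (≡true⇒T eq)
... | refl rewrite <ᵇ-irrefl s with c
...   | false = refl , refl
...   | true  = ⊥-elim (proj₂ (T-∧⁻ {s ≡ᵇ s} cf))

<⇒canFollow : ∀ p q → size q < size p → T (canFollow p q)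
<⇒canFollow p q q<p = Equivalence.from T-∨ (inj₁ (<⇒<ᵇ q<p))

-- Toggling the overline at a repeated size

flipOverline : Part → Part
flipOverline (s , b) = s , not b

toggleRepeatFrom : Part → List Part → List Part
toggleRepeatFrom p []       = p ∷ []
toggleRepeatFrom p (q ∷ qs) =
  if size p ≡ᵇ size q then flipOverline p ∷ q ∷ qs else p ∷ toggleRepeatFrom q qs

toggleRepeat : List Part → List Part
toggleRepeat []       = []
toggleRepeat (p ∷ ps) = toggleRepeatFrom p ps

toggleRepeatFrom-sizes : ∀ p ps → map size (toggleRepeatFrom p ps) ≡ size p ∷ map size ps
toggleRepeatFrom-sizes p [] = refl
toggleRepeatFrom-sizes (s , b) ((t , c) ∷ qs) with s ≡ᵇ t
... | true  = refl
... | false = cong (s ∷_) (toggleRepeatFrom-sizes (t , c) qs)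

toggleRepeat-sizes : ∀ π → map size (toggleRepeat π) ≡ map size π
toggleRepeat-sizes []       = refl
toggleRepeat-sizes (p ∷ ps) = toggleRepeatFrom-sizes p ps

toggleRepeatFrom-skip : ∀ p q qs → (size p ≡ᵇ size q) ≡ false →
  toggleRepeatFrom p (toggleRepeatFrom q qs) ≡ p ∷ toggleRepeat (toggleRepeatFrom q qs)
toggleRepeatFrom-skip (s , b) (t , c) [] ne rewrite ne = refl
toggleRepeatFrom-skip (s , b) (t , c) ((u , d) ∷ rs) ne with t ≡ᵇ u
... | true  rewrite ne = refl
... | false rewrite ne = refl

toggleRepeatFrom-involutive : ∀ p ps → toggleRepeat (toggleRepeatFrom p ps) ≡ p ∷ ps
toggleRepeatFrom-involutive p [] = refl
toggleRepeatFrom-involutive (s , b) ((t , c) ∷ qs) with s ≡ᵇ t in eq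
... | true rewrite eq | not-involutive b = refl
... | false = trans (toggleRepeatFrom-skip (s , b) (t , c) qs eq)
                    (cong ((s , b) ∷_) (toggleRepeatFrom-involutive (t , c) qs))

toggleRepeat-involutive : ∀ π → toggleRepeat (toggleRepeat π) ≡ π
toggleRepeat-involutive []       = refl
toggleRepeat-involutive (p ∷ ps) = toggleRepeatFrom-involutive p ps

toggleRepeatFrom-prepend : ∀ p q qs → size q < size p →
  T (ordered (toggleRepeatFrom q qs)) → T (ordered (p ∷ toggleRepeatFrom q qs))
toggleRepeatFrom-prepend p q [] q<p o = T-∧⁺ (<⇒canFollow p q q<p) o
toggleRepeatFrom-prepend p (t , c) ((u , d) ∷ rs) t<p o with t ≡ᵇ u
... | true  = T-∧⁺ (<⇒canFollow p (t , not c) t<p) o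
... | false = T-∧⁺ (<⇒canFollow p (t , c) t<p) o

toggleRepeatFrom-ordered : ∀ p ps → T (ordered (p ∷ ps)) → T (ordered (toggleRepeatFrom p ps))
toggleRepeatFrom-ordered p [] o = o
toggleRepeatFrom-ordered (s , b) ((t , c) ∷ qs) o with s ≡ᵇ t in eq
... | true  = o
... | false = toggleRepeatFrom-prepend (s , b) (t , c) qs
                (canFollow-≢⇒< (s , b) (t , c) (ordered-head (s , b) (t , c) qs o) eq)
                (toggleRepeatFrom-ordered (t , c) qs (ordered-tail (s , b) (t , c) qs o))

toggleRepeat-ordered : ∀ π → T (ordered π) → T (ordered (toggleRepeat π))
toggleRepeat-ordered []       o = o
toggleRepeat-ordered (p ∷ ps) o = toggleRepeatFrom-ordered p ps o

nonOverlinedSizes-toggleRepeatFrom : ∀ p ps → T (ordered (p ∷ ps)) → repeats (map size (p ∷ ps)) ≡ true →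
  let xs = nonOverlinedSizes (p ∷ ps); ys = nonOverlinedSizes (toggleRepeatFrom p ps)
  in Stutter xs ys ⊎ Stutter ys xs
nonOverlinedSizes-toggleRepeatFrom (s , b) ((t , c) ∷ qs) o r with s ≡ᵇ t in eq
... | true with canFollow-≡ s b t c (ordered-head (s , b) (t , c) qs o) eq
...   | refl , refl with b
...     | true  = inj₁ (duplicate s (nonOverlinedSizes qs))
...     | false = inj₂ (duplicate s (nonOverlinedSizes qs))
nonOverlinedSizes-toggleRepeatFrom (s , b) ((t , c) ∷ qs) o r | false
  with ordered-tail (s , b) (t , c) qs o | b
... | o′ | true  = nonOverlinedSizes-toggleRepeatFrom (t , c) qs o′ r
... | o′ | false = Sum.map (skip s) (skip s) (nonOverlinedSizes-toggleRepeatFrom (t , c) qs o′ r)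

overlinedCount : (ℕ → Bool) → List Part → ℕ
overlinedCount P = countParts (λ p → overlined p ∧ P (size p))

overlinedCount-toggleRepeatFrom : ∀ (P : ℕ → Bool) p ps → T (ordered (p ∷ ps)) →
  repeats (map size (p ∷ ps)) ≡ true → (∀ {d} → d ∈ nonOverlinedSizes (p ∷ ps) → P d ≡ true) →
  let m = overlinedCount P (toggleRepeatFrom p ps); n = overlinedCount P (p ∷ ps)
  in m ≡ suc n ⊎ suc m ≡ n
overlinedCount-toggleRepeatFrom P (s , b) ((t , c) ∷ qs) o r P-nonO with s ≡ᵇ t in eq
... | true with canFollow-≡ s b t c (ordered-head (s , b) (t , c) qs o) eq
...   | refl , refl with b | P-nonO {s}
...     | true  | Ps rewrite Ps (here refl) = inj₂ refl
...     | false | Ps rewrite Ps (here refl) = inj₁ refl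
overlinedCount-toggleRepeatFrom P (s , b) ((t , c) ∷ qs) o r P-nonO | false
  with ordered-tail (s , b) (t , c) qs o | b | P s
... | o′ | false | _     = overlinedCount-toggleRepeatFrom P (t , c) qs o′ r (P-nonO ∘ there)
... | o′ | true  | false = overlinedCount-toggleRepeatFrom P (t , c) qs o′ r P-nonO
... | o′ | true  | true  = Sum.map (cong suc) (cong suc) (overlinedCount-toggleRepeatFrom P (t , c) qs o′ r P-nonO)

toggleRepeat-stutter : ∀ π → T (ordered π) → repeats (map size π) ≡ true →
  let xs = nonOverlinedSizes π; ys = nonOverlinedSizes (toggleRepeat π)
  in Stutter xs ys ⊎ Stutter ys xs
toggleRepeat-stutter (p ∷ ps) = nonOverlinedSizes-toggleRepeatFrom p ps

toggleRepeat-nonOverlined-invariant : {X : Set} (F : List ℕ → X) →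
  (∀ {xs ys} → Stutter xs ys → F xs ≡ F ys) →
  ∀ π → T (ordered π) → repeats (map size π) ≡ true →
  F (nonOverlinedSizes (toggleRepeat π)) ≡ F (nonOverlinedSizes π)
toggleRepeat-nonOverlined-invariant F F-stutter π o r =
  [ sym ∘ F-stutter , F-stutter ]′ (toggleRepeat-stutter π o r)

SN-toggleRepeat : ∀ π → T (ordered π) → repeats (map size π) ≡ true → SN (toggleRepeat π) ≡ SN π
SN-toggleRepeat π o r = begin
  SN (toggleRepeat π)
    ≡⟨ SN≡smallest (toggleRepeat π) ⟩
  smallest (nonOverlinedSizes (toggleRepeat π))
    ≡⟨ toggleRepeat-nonOverlined-invariant smallest smallest-stutter π o r ⟩
  smallest (nonOverlinedSizes π)
    ≡⟨ SN≡smallest π ⟨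
  SN π ∎
  where open ≡-Reasoning

LN~-toggleRepeat : ∀ π → T (ordered π) → repeats (map size π) ≡ true → LN~ (toggleRepeat π) ≡ LN~ π
LN~-toggleRepeat π o r = begin
  LN~ (toggleRepeat π)
    ≡⟨ LN~≡largest (toggleRepeat π) ⟩
  largest (nonOverlinedSizes (toggleRepeat π))
    ≡⟨ toggleRepeat-nonOverlined-invariant largest largest-stutter π o r ⟩
  largest (nonOverlinedSizes π)
    ≡⟨ LN~≡largest π ⟨
  LN~ π ∎
  where open ≡-Reasoning

hasNonOverlined-toggleRepeat : ∀ π → T (ordered π) → repeats (map size π) ≡ true →
  hasNonOverlined (toggleRepeat π) ≡ hasNonOverlined π
hasNonOverlined-toggleRepeat π o r = begin
  hasNonOverlined (toggleRepeat π)
    ≡⟨ hasNonOverlined≡not-null (toggleRepeat π) ⟩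
  not (null (nonOverlinedSizes (toggleRepeat π)))
    ≡⟨ cong not (toggleRepeat-nonOverlined-invariant null null-stutter π o r) ⟩
  not (null (nonOverlinedSizes π))
    ≡⟨ hasNonOverlined≡not-null π ⟨
  hasNonOverlined π ∎
  where open ≡-Reasoning

-- The toggled size is non-overlined, so P holds there.
isEven-overlinedCount-toggleRepeat : ∀ (P : ℕ → Bool) π → T (ordered π) → repeats (map size π) ≡ true →
  (∀ {d} → d ∈ nonOverlinedSizes π → P d ≡ true) →
  isEven (overlinedCount P (toggleRepeat π)) ≡ not (isEven (overlinedCount P π))
isEven-overlinedCount-toggleRepeat P (p ∷ ps) o r P-nonO =
  isEven-neighbours (overlinedCount-toggleRepeatFrom P p ps o r P-nonO)

ℓO≥N-toggleRepeat : ∀ π → T (ordered π) → repeats (map size π) ≡ true →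
  isEven (ℓO≥N (toggleRepeat π)) ≡ not (isEven (ℓO≥N π))
ℓO≥N-toggleRepeat π o r =
  trans (cong (λ m → isEven (overlinedCount (m ≤ᵇ_) (toggleRepeat π))) (SN-toggleRepeat π o r))
        (isEven-overlinedCount-toggleRepeat (SN π ≤ᵇ_) π o r SN≤)
  where
  SN≤ : ∀ {d} → d ∈ nonOverlinedSizes π → (SN π ≤ᵇ d) ≡ true
  SN≤ d∈ = ≤⇒≤ᵇ≡true (subst (_≤ _) (sym (SN≡smallest π)) (smallest≤∈ _ d∈))

ℓO≤N-toggleRepeat : ∀ π → T (ordered π) → repeats (map size π) ≡ true →
  isEven (ℓO≤N (toggleRepeat π)) ≡ not (isEven (ℓO≤N π))
ℓO≤N-toggleRepeat π o r =
  trans (cong (λ m → isEven (overlinedCount (λ k → ≤∞ᵇ k m) (toggleRepeat π))) (LN~-toggleRepeat π o r))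
        (isEven-overlinedCount-toggleRepeat (λ k → ≤∞ᵇ k (LN~ π)) π o r ≤LN~)
  where
  ≤LN~ : ∀ {d} → d ∈ nonOverlinedSizes π → ≤∞ᵇ d (LN~ π) ≡ true
  ≤LN~ {d} d∈ = subst (λ m → ≤∞ᵇ d m ≡ true) (sym (LN~≡largest π)) (∈≤largest _ d∈)

-- Reversing the overline marks

overlines : List Part → List Bool
overlines = map overlined

reverseOverlines : List Part → List Part
reverseOverlines π = zip (map size π) (reverse (overlines π))

unzip≡maps : {A B : Set} (xs : List (A × B)) → unzip xs ≡ (map proj₁ xs , map proj₂ xs)
unzip≡maps []       = refl
unzip≡maps (x ∷ xs) = cong (Product.zip _∷_ _∷_ x) (unzip≡maps xs)

unzip-reverseOverlines : ∀ π →
  (map size (reverseOverlines π) , overlines (reverseOverlines π)) ≡ (map size π , reverse (overlines π))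
unzip-reverseOverlines π = trans (sym (unzip≡maps (reverseOverlines π))) (unzip-zip _ _ same-length)
  where
  same-length : length (map size π) ≡ length (reverse (overlines π))
  same-length = trans (length-map size π) (sym (trans (length-reverse (overlines π)) (length-map overlined π)))

reverseOverlines-sizes : ∀ π → map size (reverseOverlines π) ≡ map size π
reverseOverlines-sizes π = cong proj₁ (unzip-reverseOverlines π)

overlines-reverseOverlines : ∀ π → overlines (reverseOverlines π) ≡ reverse (overlines π)
overlines-reverseOverlines π = cong proj₂ (unzip-reverseOverlines π)

reverseOverlines-involutive : ∀ π → reverseOverlines (reverseOverlines π) ≡ π
reverseOverlines-involutive π = begin
  zip (map size (reverseOverlines π)) (reverse (overlines (reverseOverlines π)))
    ≡⟨ cong₂ zip (reverseOverlines-sizes π) (cong reverse (overlines-reverseOverlines π)) ⟩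
  zip (map size π) (reverse (reverse (overlines π)))
    ≡⟨ cong (zip (map size π)) (reverse-involutive (overlines π)) ⟩
  zip (map proj₁ π) (map proj₂ π)
    ≡⟨ cong (λ (xs , ys) → zip xs ys) (unzip≡maps π) ⟨
  zip (proj₁ (unzip π)) (proj₂ (unzip π))
    ≡⟨ zip-unzip π ⟩
  π ∎
  where open ≡-Reasoning

countTrue : List Bool → ℕ
countTrue []       = 0
countTrue (b ∷ bs) = if b then suc (countTrue bs) else countTrue bs

-- When there is no false, every true counts: this mirrors SN = 0 and LN~ = +∞.
truesBeforeLastFalse : List Bool → ℕ
truesBeforeLastFalse []       = 0
truesBeforeLastFalse (b ∷ bs) =
  if and bs then (if b then suc (countTrue bs) else 0)
  else (if b then suc (truesBeforeLastFalse bs) else truesBeforeLastFalse bs)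

truesAfterFirstFalse : List Bool → ℕ
truesAfterFirstFalse []       = 0
truesAfterFirstFalse (b ∷ bs) =
  if b then (if and bs then suc (countTrue bs) else truesAfterFirstFalse bs)
  else countTrue bs

and-∷ʳ : ∀ bs b → and (bs ∷ʳ b) ≡ and bs ∧ b
and-∷ʳ []          b = ∧-identityʳ b
and-∷ʳ (true ∷ bs)  b = and-∷ʳ bs b
and-∷ʳ (false ∷ bs) b = refl

countTrue-∷ʳ : ∀ bs b → countTrue (bs ∷ʳ b) ≡ (if b then suc (countTrue bs) else countTrue bs)
countTrue-∷ʳ []          b = refl
countTrue-∷ʳ (true ∷ bs)  b = trans (cong suc (countTrue-∷ʳ bs b)) (if-float suc b)
countTrue-∷ʳ (false ∷ bs) b = countTrue-∷ʳ bs b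

truesBeforeLastFalse-∷ʳ : ∀ bs b → truesBeforeLastFalse (bs ∷ʳ b) ≡
  (if b then (if and bs then suc (countTrue bs) else truesBeforeLastFalse bs) else countTrue bs)
truesBeforeLastFalse-∷ʳ []       b = refl
truesBeforeLastFalse-∷ʳ (x ∷ bs) b
  rewrite and-∷ʳ bs b | countTrue-∷ʳ bs b | truesBeforeLastFalse-∷ʳ bs b with b | x | and bs
... | true  | true  | true  = refl
... | true  | true  | false = refl
... | true  | false | true  = refl
... | true  | false | false = refl
... | false | true  | true  = refl
... | false | true  | false = refl
... | false | false | true  = refl
... | false | false | false = refl

and-reverse : ∀ bs → and (reverse bs) ≡ and bs
and-reverse []       = refl
and-reverse (b ∷ bs)
  rewrite unfold-reverse b bs | and-∷ʳ (reverse bs) b | and-reverse bs = ∧-comm (and bs) b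

countTrue-reverse : ∀ bs → countTrue (reverse bs) ≡ countTrue bs
countTrue-reverse []       = refl
countTrue-reverse (b ∷ bs)
  rewrite unfold-reverse b bs | countTrue-∷ʳ (reverse bs) b | countTrue-reverse bs = refl

truesBeforeLastFalse-reverse : ∀ bs → truesBeforeLastFalse (reverse bs) ≡ truesAfterFirstFalse bs
truesBeforeLastFalse-reverse []       = refl
truesBeforeLastFalse-reverse (b ∷ bs)
  rewrite unfold-reverse b bs | truesBeforeLastFalse-∷ʳ (reverse bs) b | and-reverse bs
        | countTrue-reverse bs | truesBeforeLastFalse-reverse bs = refl

below-head : ∀ {s xs} → Linked _>_ (s ∷ xs) → All (_< s) xs
below-head [-]         = []
below-head (s>x ∷ dec) = Linked⇒All (λ y>z z>w → <-trans z>w y>z) s>x dec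

nonOverlined-below : ∀ {s} ps → All (_< s) (map size ps) → All (_< s) (nonOverlinedSizes ps)
nonOverlined-below []                  []           = []
nonOverlined-below ((t , true)  ∷ qs) (_ ∷ qs<s)   = nonOverlined-below qs qs<s
nonOverlined-below ((t , false) ∷ qs) (t<s ∷ qs<s) = t<s ∷ nonOverlined-below qs qs<s

null-nonOverlined : ∀ ps → null (nonOverlinedSizes ps) ≡ and (overlines ps)
null-nonOverlined []                 = refl
null-nonOverlined ((t , true)  ∷ qs) = null-nonOverlined qs
null-nonOverlined ((t , false) ∷ qs) = refl

and-overlines : ∀ ps {xs} → nonOverlinedSizes ps ≡ xs → and (overlines ps) ≡ null xs
and-overlines ps eq = trans (sym (null-nonOverlined ps)) (cong null eq)

overlinedCount-all : ∀ ps → overlinedCount (λ _ → true) ps ≡ countTrue (overlines ps)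
overlinedCount-all []                 = refl
overlinedCount-all ((t , true)  ∷ qs) = cong suc (overlinedCount-all qs)
overlinedCount-all ((t , false) ∷ qs) = overlinedCount-all qs

overlinedCount-above : ∀ {s} ps → All (_< s) (map size ps) → overlinedCount (s ≤ᵇ_) ps ≡ 0
overlinedCount-above []             []           = refl
overlinedCount-above ((t , c) ∷ qs) (t<s ∷ qs<s) rewrite <⇒≤ᵇ≡false t<s with c
... | true  = overlinedCount-above qs qs<s
... | false = overlinedCount-above qs qs<s

overlinedCount-below : ∀ {s} ps → All (_< s) (map size ps) →
  overlinedCount (_≤ᵇ s) ps ≡ countTrue (overlines ps)
overlinedCount-below []             []           = refl
overlinedCount-below ((t , c) ∷ qs) (t<s ∷ qs<s) rewrite ≤⇒≤ᵇ≡true (<⇒≤ t<s) with c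
... | true  = cong suc (overlinedCount-below qs qs<s)
... | false = overlinedCount-below qs qs<s

overlinedCount-∷-pass : ∀ (P : ℕ → Bool) s b ps → P s ≡ true →
  overlinedCount P ((s , b) ∷ ps) ≡ (if b then suc (overlinedCount P ps) else overlinedCount P ps)
overlinedCount-∷-pass P s true  ps Ps rewrite Ps = refl
overlinedCount-∷-pass P s false ps Ps = refl

overlinedCount-∷-fail : ∀ (P : ℕ → Bool) s b ps → P s ≡ false →
  overlinedCount P ((s , b) ∷ ps) ≡ overlinedCount P ps
overlinedCount-∷-fail P s true  ps Ps rewrite Ps = refl
overlinedCount-∷-fail P s false ps Ps = refl

ℓO≥N-at : ∀ π {t} → SN π ≡ t → ℓO≥N π ≡ overlinedCount (t ≤ᵇ_) π
ℓO≥N-at π refl = refl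

ℓO≤N-at : ∀ π {m} → LN~ π ≡ m → ℓO≤N π ≡ overlinedCount (λ k → ≤∞ᵇ k m) π
ℓO≤N-at π refl = refl

SN-∷-above : ∀ s b ps {x xs} → nonOverlinedSizes ps ≡ x ∷ xs → x < s → SN ((s , b) ∷ ps) ≡ SN ps
SN-∷-above s b ps {x} {xs} eq x<s = begin
  SN ((s , b) ∷ ps)                            ≡⟨ SN≡smallest ((s , b) ∷ ps) ⟩
  smallest (nonOverlinedSizes ((s , b) ∷ ps))  ≡⟨ head-irrelevant b ⟩
  smallest (nonOverlinedSizes ps)              ≡⟨ SN≡smallest ps ⟨
  SN ps                                        ∎
  where
  open ≡-Reasoning
  head-irrelevant : ∀ b → smallest (nonOverlinedSizes ((s , b) ∷ ps)) ≡ smallest (nonOverlinedSizes ps)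
  head-irrelevant true  = refl
  head-irrelevant false rewrite eq = minL-below-seed xs x<s

ℓO≥N-decreasing : ∀ π → Linked _>_ (map size π) → ℓO≥N π ≡ truesBeforeLastFalse (overlines π)
ℓO≥N-decreasing [] _ = refl
ℓO≥N-decreasing ((s , b₀) ∷ ps) dec = go b₀ (nonOverlinedSizes ps) refl
  where
  open ≡-Reasoning
  ps<s : All (_< s) (map size ps)
  ps<s = below-head dec
  go : ∀ b xs → nonOverlinedSizes ps ≡ xs → ℓO≥N ((s , b) ∷ ps) ≡ truesBeforeLastFalse (b ∷ overlines ps)
  go true [] eq rewrite and-overlines ps eq =
    trans (ℓO≥N-at ((s , true) ∷ ps) (trans (SN≡smallest ((s , true) ∷ ps)) (cong smallest eq)))
          (cong suc (overlinedCount-all ps))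
  go false [] eq rewrite and-overlines ps eq =
    trans (ℓO≥N-at ((s , false) ∷ ps) (trans (SN≡smallest ((s , false) ∷ ps)) (cong (minL s) eq)))
          (overlinedCount-above ps ps<s)
  go b (x ∷ xs) eq rewrite and-overlines ps eq = begin
    ℓO≥N ((s , b) ∷ ps)
      ≡⟨ ℓO≥N-at ((s , b) ∷ ps) (SN-∷-above s b ps eq x<s) ⟩
    overlinedCount (SN ps ≤ᵇ_) ((s , b) ∷ ps)
      ≡⟨ overlinedCount-∷-pass (SN ps ≤ᵇ_) s b ps SN≤s ⟩
    (if b then suc (ℓO≥N ps) else ℓO≥N ps)
      ≡⟨ cong (λ m → if b then suc m else m) (ℓO≥N-decreasing ps (Linked.tail dec)) ⟩
    (if b then suc (truesBeforeLastFalse (overlines ps)) else truesBeforeLastFalse (overlines ps))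
      ∎
    where
    x<s : x < s
    x<s = All.head (subst (All (_< s)) eq (nonOverlined-below ps ps<s))
    SN≡minL : SN ps ≡ minL x xs
    SN≡minL = trans (SN≡smallest ps) (cong smallest eq)
    SN≤s : (SN ps ≤ᵇ s) ≡ true
    SN≤s = ≤⇒≤ᵇ≡true (≤-trans (subst (_≤ x) (sym SN≡minL) (minL≤seed x xs)) (<⇒≤ x<s))

ℓO≤N-decreasing : ∀ π → Linked _>_ (map size π) → ℓO≤N π ≡ truesAfterFirstFalse (overlines π)
ℓO≤N-decreasing [] _ = refl
ℓO≤N-decreasing ((s , b₀) ∷ ps) dec = go b₀ (nonOverlinedSizes ps) refl
  where
  ps<s : All (_< s) (map size ps)
  ps<s = below-head dec
  go : ∀ b xs → nonOverlinedSizes ps ≡ xs → ℓO≤N ((s , b) ∷ ps) ≡ truesAfterFirstFalse (b ∷ overlines ps)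
  go false _ _ =
    trans (ℓO≤N-at ((s , false) ∷ ps)
            (trans (LN~≡largest ((s , false) ∷ ps)) (cong just (maxL-seed s _ (nonOverlined-below ps ps<s)))))
          (overlinedCount-below ps ps<s)
  go true [] eq rewrite and-overlines ps eq =
    trans (ℓO≤N-at ((s , true) ∷ ps) (trans (LN~≡largest ((s , true) ∷ ps)) (cong largest eq)))
          (cong suc (overlinedCount-all ps))
  go true (x ∷ xs) eq rewrite and-overlines ps eq = begin
    ℓO≤N ((s , true) ∷ ps)                  ≡⟨ ℓO≤N-at ((s , true) ∷ ps) LN~≡max ⟩
    overlinedCount ≤max ((s , true) ∷ ps)   ≡⟨ overlinedCount-∷-fail ≤max s true ps (<⇒≤ᵇ≡false max<s) ⟩
    overlinedCount ≤max ps                  ≡⟨ ℓO≤N-at ps (trans (LN~≡largest ps) (cong largest eq)) ⟨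
    ℓO≤N ps                                 ≡⟨ ℓO≤N-decreasing ps (Linked.tail dec) ⟩
    truesAfterFirstFalse (overlines ps)     ∎
    where
    open ≡-Reasoning
    ≤max : ℕ → Bool
    ≤max k = ≤∞ᵇ k (just (maxL x xs))
    LN~≡max : LN~ ((s , true) ∷ ps) ≡ just (maxL x xs)
    LN~≡max = trans (LN~≡largest ((s , true) ∷ ps)) (cong largest eq)
    max<s : maxL x xs < s
    max<s = maxL< x xs (subst (All (_< s)) eq (nonOverlined-below ps ps<s))

ordered⇒decreasing : ∀ π → T (ordered π) → repeats (map size π) ≡ false → Linked _>_ (map size π)
ordered⇒decreasing []           _ _ = []
ordered⇒decreasing (p ∷ [])     _ _ = [-]
ordered⇒decreasing (p ∷ q ∷ qs) o r =
  canFollow-≢⇒< p q (ordered-head p q qs o) (∨-conicalˡ _ _ r)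
    ∷ ordered⇒decreasing (q ∷ qs) (ordered-tail p q qs o) (∨-conicalʳ _ _ r)

decreasing⇒ordered : ∀ π → Linked _>_ (map size π) → T (ordered π)
decreasing⇒ordered []           _           = tt
decreasing⇒ordered (p ∷ [])     _           = tt
decreasing⇒ordered (p ∷ q ∷ qs) (q<p ∷ dec) = T-∧⁺ (<⇒canFollow p q q<p) (decreasing⇒ordered (q ∷ qs) dec)

reverseOverlines-decreasing : ∀ π → Linked _>_ (map size π) → Linked _>_ (map size (reverseOverlines π))
reverseOverlines-decreasing π = subst (Linked _>_) (sym (reverseOverlines-sizes π))

ℓO≤N-reverseOverlines : ∀ π → Linked _>_ (map size π) → ℓO≤N (reverseOverlines π) ≡ ℓO≥N π
ℓO≤N-reverseOverlines π dec = begin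
  ℓO≤N (reverseOverlines π)
    ≡⟨ ℓO≤N-decreasing (reverseOverlines π) (reverseOverlines-decreasing π dec) ⟩
  truesAfterFirstFalse (overlines (reverseOverlines π))
    ≡⟨ cong truesAfterFirstFalse (overlines-reverseOverlines π) ⟩
  truesAfterFirstFalse (reverse (overlines π))
    ≡⟨ truesBeforeLastFalse-reverse (reverse (overlines π)) ⟨
  truesBeforeLastFalse (reverse (reverse (overlines π)))
    ≡⟨ cong truesBeforeLastFalse (reverse-involutive (overlines π)) ⟩
  truesBeforeLastFalse (overlines π)
    ≡⟨ ℓO≥N-decreasing π dec ⟨
  ℓO≥N π ∎
  where open ≡-Reasoning

hasNonOverlined-reverseOverlines : ∀ π → hasNonOverlined (reverseOverlines π) ≡ hasNonOverlined π
hasNonOverlined-reverseOverlines π = begin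
  hasNonOverlined (reverseOverlines π)
    ≡⟨ hasNonOverlined≡not-null (reverseOverlines π) ⟩
  not (null (nonOverlinedSizes (reverseOverlines π)))
    ≡⟨ cong not (null-nonOverlined (reverseOverlines π)) ⟩
  not (and (overlines (reverseOverlines π)))
    ≡⟨ cong (not ∘ and) (overlines-reverseOverlines π) ⟩
  not (and (reverse (overlines π)))
    ≡⟨ cong not (and-reverse (overlines π)) ⟩
  not (and (overlines π))
    ≡⟨ cong not (null-nonOverlined π) ⟨
  not (null (nonOverlinedSizes π))
    ≡⟨ hasNonOverlined≡not-null π ⟨
  hasNonOverlined π ∎
  where open ≡-Reasoning

module OverpartitionInvolution (n : ℕ) where

  private
    ordered-of : ∀ π → T (isOverpartitionOf n π) → T (ordered π)
    ordered-of π v = proj₁ (T-∧⁻ {ordered π} (proj₂ (T-∧⁻ {allPositive π} v)))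

    decreasing-of : ∀ π → T (isOverpartitionOf n π) → repeats (map size π) ≡ false → Linked _>_ (map size π)
    decreasing-of π v = ordered⇒decreasing π (ordered-of π v)

    module P = PiecewiseInvolution (isOverpartitionOf n) (isEven ∘ ℓO≥N) (isEven ∘ ℓO≤N) (repeats ∘ map size)
      toggleRepeat reverseOverlines
      (λ π v _ → isOverpartitionOf-resize n (toggleRepeat-sizes π) (toggleRepeat-ordered π (ordered-of π v)) v)
      (λ π _ r → trans (cong repeats (toggleRepeat-sizes π)) r)
      (λ π _ _ → toggleRepeat-involutive π)
      (λ π v r → ℓO≥N-toggleRepeat π (ordered-of π v) r)
      (λ π v r → ℓO≤N-toggleRepeat π (ordered-of π v) r)
      (λ π v r → isOverpartitionOf-resize n (reverseOverlines-sizes π)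
                   (decreasing⇒ordered (reverseOverlines π) (reverseOverlines-decreasing π (decreasing-of π v r))) v)
      (λ π _ r → trans (cong repeats (reverseOverlines-sizes π)) r)
      (λ π _ _ → reverseOverlines-involutive π)
      (λ π v r → cong isEven (ℓO≤N-reverseOverlines π (decreasing-of π v r)))

  open P public using (involution)

  hasNonOverlined-φ : ∀ π → T (isOverpartitionOf n π) → hasNonOverlined (P.φ π) ≡ hasNonOverlined π
  hasNonOverlined-φ = P.φ-invariant hasNonOverlined
    (λ π v r → hasNonOverlined-toggleRepeat π (ordered-of π v) r)
    (λ π _ _ → hasNonOverlined-reverseOverlines π)

corollary1p5 : (n : ℕ) → n ≥ 1 → (e : Bool) →
    ((Σ (List Part) (λ π → T (isOverpartitionOf n π) × (isEven (ℓO≥N π) ≡ e)))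
      ↔ (Σ (List Part) (λ μ → T (isOverpartitionOf n μ) × (isEven (ℓO≤N μ) ≡ e))))
    × ((Σ (List Part) (λ π → T (isOverpartitionOf n π ∧ hasNonOverlined π) × (isEven (ℓO≥N π) ≡ e)))
      ↔ (Σ (List Part) (λ μ → T (isOverpartitionOf n μ ∧ hasNonOverlined μ) × (isEven (ℓO≤N μ) ≡ e))))
corollary1p5 n _ e =
  ↔-exchange e , InvolutionExchanging.↔-exchange (restrict hasNonOverlined hasNonOverlined-φ) e
  where
  open OverpartitionInvolution n
  open InvolutionExchanging involution
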